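{- Let $\mathcal M=\langle W,R,\{\mathcal M_w\}_{w\in W}\rangle$ be a concrete mixed model with $\mathcal M_w=\langle W_w,\leq_w,V_w\rangle$. Define $\mathcal M'=\langle W',\leq',R',V'\rangle$ by: $W':=\bigcup_{w\in W}W_w$; $xR'y$ iff there are $w,v\in W$ with $wRv$, $\overline w\leq_w x$ and $y=\overline v$; $x\leq'y$ iff $x\leq_w y$ for some $w\in W$; $V'(x):=V_w(x)$ for the unique $w$ with $x\in W_w$. Then $\mathcal M'$ is a birelational model satisfying $\mathsf{BEM}$, and for every $x\in W'$ and every $\varphi\in\mathsf{Form}_\Box$, $\mathcal M,x\Vdash\varphi$ if and only if $\mathcal M',x\Vdash\varphi$.
   Context: The modal language $\mathsf{Form}_\Box$ is generated by $\top$, $\bot$, propositional variables $p\in\mathsf{Prop}$, $\wedge,\vee,\to$ and $\Box$. A concrete mixed model is $\langle W,R,\{\mathcal M_w\}_{w\in W}\rangle$ with $W\ne\emptyset$, $R\subseteq W\times W$, each $\mathcal M_w=\langle W_w,\leq_w,V_w\rangle$ a rooted intuitionistic Kripke model (partial order $\leq_w$ with least element $\overline w$, valuation $V_w:W_w\to\mathcal P(\mathsf{Prop})$ monotone in $\leq_w$), the $W_w$ pairwise disjoint; $\leq,V$ denote the unions. Forcing at a point $x\in\bigcup_wW_w$: $x\Vdash p$ iff $p\in V(x)$; $x\nVdash\bot$; $\wedge,\vee$ pointwise; $x\Vdash\varphi\to\psi$ iff every $y\geq x$ forcing $\varphi$ forces $\psi$; $x\Vdash\Box\varphi$ iff $\overline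 v\Vdash\varphi$ for all $v\in W$ with $wRv$, where $w$ is the unique element with $\overline w\leq x$. A birelational model is $\langle U,\leq,R,V\rangle$ with $U\ne\emptyset$, $\leq$ a partial order, $R\subseteq U\times U$ such that $x\leq y$ and $yRz$ imply $xRz$, and $V:U\to\mathcal P(\mathsf{Prop})$ monotone in $\leq$. Forcing is as in intuitionistic Kripke models for propositional clauses, and $x\Vdash\Box\varphi$ iff $y\Vdash\varphi$ for all $y$ with $xRy$. The condition $\mathsf{BEM}$ is: $x\leq y$ and $xRz$ imply $yRz$. -}

module Defs where

open import Data.Unit using (⊤)
open import Data.Empty using (⊥)
open import Data.Product using (Σ; Σ-syntax; _×_; _,_)
open import Data.Sum using (_⊎_)
open import Relation.Binary.PropositionalEquality using (_≡_)
open import Relation.Binary.Structures using (IsPartialOrder)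

data Form (Prop : Set) : Set where
  `⊤ `⊥ : Form Prop
  var   : Prop → Form Prop
  _∧_ _∨_ _⇒_ : Form Prop → Form Prop → Form Prop
  □_    : Form Prop → Form Prop

record RootedKripke (Prop : Set) : Set₁ where
  field
    Pt    : Set
    _≤_   : Pt → Pt → Set
    isPO  : IsPartialOrder _≡_ _≤_
    root  : Pt
    least : ∀ x → root ≤ x
    V     : Pt → Prop → Set
    mono  : ∀ {x y} → x ≤ y → ∀ p → V x p → V y p

-- Concrete mixed model.  The union of the W_w is the disjoint union Σ W Pt_w,
-- so pairwise disjointness holds by construction.
record MixedModel (Prop : Set) : Set₁ where
  field
    W    : Set
    inh  : W
    R    : W → W → Set
    M    : W → RootedKripke Prop

  module M (w : W) = RootedKripke (M w)

  Pt : Set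
  Pt = Σ W M.Pt

  _⊩_ : Pt → Form Prop → Set
  x ⊩ `⊤ = ⊤
  x ⊩ `⊥ = ⊥
  (w , x) ⊩ var p = M.V w x p
  x ⊩ (φ ∧ ψ) = (x ⊩ φ) × (x ⊩ ψ)
  x ⊩ (φ ∨ ψ) = (x ⊩ φ) ⊎ (x ⊩ ψ)
  (w , x) ⊩ (φ ⇒ ψ) = ∀ (y : M.Pt w) → M._≤_ w x y → (w , y) ⊩ φ → (w , y) ⊩ ψ
  (w , x) ⊩ (□ φ) = ∀ v → R w v → (v , M.root v) ⊩ φ

record IsBirelational {U : Set} (_≤_ : U → U → Set) (R : U → U → Set)
                      {Prop : Set} (V : U → Prop → Set) : Set where
  field
    nonempty : U
    isPO     : IsPartialOrder _≡_ _≤_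
    ≤R⇒R     : ∀ {x y z} → x ≤ y → R y z → R x z
    mono     : ∀ {x y} → x ≤ y → ∀ p → V x p → V y p

BEM : {U : Set} (_≤_ : U → U → Set) (R : U → U → Set) → Set
BEM _≤_ R = ∀ {x y z} → x ≤ y → R x z → R y z

force : {U : Set} (_≤_ : U → U → Set) (R : U → U → Set)
        {Prop : Set} (V : U → Prop → Set) → U → Form Prop → Set
force _≤_ R V x `⊤ = ⊤
force _≤_ R V x `⊥ = ⊥
force _≤_ R V x (var p) = V x p
force _≤_ R V x (φ ∧ ψ) = force _≤_ R V x φ × force _≤_ R V x ψ
force _≤_ R V x (φ ∨ ψ) = force _≤_ R V x φ ⊎ force _≤_ R V x ψ
force _≤_ R V x (φ ⇒ ψ) = ∀ y → x ≤ y → force _≤_ R V y φ → force _≤_ R V y ψ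
force _≤_ R V x (□ φ) = ∀ y → R x y → force _≤_ R V y φ

module Construction {Prop : Set} (𝓜 : MixedModel Prop) where
  open MixedModel 𝓜

  W' : Set
  W' = Pt

  data _≤'_ : W' → W' → Set where
    inW : ∀ {w} {x y : M.Pt w} → M._≤_ w x y → (w , x) ≤' (w , y)

  _R'_ : W' → W' → Set
  x R' y = Σ[ w ∈ W ] Σ[ v ∈ W ] (R w v × ((w , M.root w) ≤' x) × (y ≡ (v , M.root v)))

  V' : W' → Prop → Set
  V' (w , x) = M.V w x

  _⊩'_ : W' → Form Prop → Set
  _⊩'_ = force _≤'_ _R'_ V'

{-# OPTIONS --safe #-}
module Submission where

-- M' has the same points as M, and its order only relates points of one W_w,
-- so the clauses for the propositional connectives match.  Moreover x R' z holds
-- iff z is the root of an R-successor of the world containing x; hence R' depends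
-- only on that world, which gives both frame conditions, and the □-clause of M'
-- quantifies over exactly the points the mixed □-clause inspects.

open import Defs
open import Data.Product using (_×_; _,_; Σ-syntax)
open import Data.Product.Function.NonDependent.Propositional using (_×-⇔_)
open import Data.Sum.Function.Propositional using (_⊎-⇔_)
open import Function.Base using (_∘_)
open import Function.Bundles using (_⇔_; mk⇔; Equivalence)
open import Function.Construct.Composition using (_⇔-∘_)
open import Function.Construct.Identity using (⇔-id)
open import Function.Construct.Symmetry using (⇔-sym)
open import Function.Related.TypeIsomorphisms using (→-cong-⇔)
open import Relation.Binary.PropositionalEquality using (_≡_; refl; cong; isEquivalence)
open import Relation.Binary.Structures using (IsPartialOrder)

open Equivalence using (to; from)

Π-cong-⇔ : {A : Set} {B C : A → Set} → (∀ a → B a ⇔ C a) → ((a : A) → B a) ⇔ ((a : A) → C a)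
Π-cong-⇔ B⇔C = mk⇔ (λ f a → to (B⇔C a) (f a)) (λ g a → from (B⇔C a) (g a))

module _ {Prop : Set} (𝓜 : MixedModel Prop) where
  open MixedModel 𝓜
  open Construction 𝓜

  module ≤ (w : W) = IsPartialOrder (M.isPO w)

  ≤'-reflexive : ∀ {x y} → x ≡ y → x ≤' y
  ≤'-reflexive {w , x} refl = inW (≤.refl w)

  ≤'-trans : ∀ {x y z} → x ≤' y → y ≤' z → x ≤' z
  ≤'-trans (inW {w} x≤y) (inW y≤z) = inW (≤.trans w x≤y y≤z)

  ≤'-antisym : ∀ {x y} → x ≤' y → y ≤' x → x ≡ y
  ≤'-antisym (inW {w} x≤y) (inW y≤x) = cong (w ,_) (≤.antisym w x≤y y≤x)

  ≤'-isPartialOrder : IsPartialOrder _≡_ _≤'_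
  ≤'-isPartialOrder = record
    { isPreorder = record
      { isEquivalence = isEquivalence
      ; reflexive     = ≤'-reflexive
      ; trans         = ≤'-trans
      }
    ; antisym = ≤'-antisym
    }

  V'-mono : ∀ {x y} → x ≤' y → ∀ p → V' x p → V' y p
  V'-mono (inW {w} x≤y) = M.mono w x≤y

  R'-successors : ∀ {w x z} → (w , x) R' z ⇔ (Σ[ v ∈ W ] R w v × z ≡ (v , M.root v))
  R'-successors {w} {x} = mk⇔
    (λ { (_ , v , wRv , inW _ , z≡root) → v , wRv , z≡root })
    (λ { (v , wRv , z≡root) → w , v , wRv , inW (M.least w x) , z≡root })

  R'-sameWorld : ∀ {w x y z} → (w , x) R' z → (w , y) R' z
  R'-sameWorld = from R'-successors ∘ to R'-successors

  ≤'-R'-isBirelational : IsBirelational _≤'_ _R'_ V'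
  ≤'-R'-isBirelational = record
    { nonempty = inh , M.root inh
    ; isPO     = ≤'-isPartialOrder
    ; ≤R⇒R     = λ { (inW _) → R'-sameWorld }
    ; mono     = V'-mono
    }

  ≤'-R'-BEM : BEM _≤'_ _R'_
  ≤'-R'-BEM (inW _) = R'-sameWorld

  ⊩'-⇒ : ∀ {w x} φ ψ →
         (w , x) ⊩' (φ ⇒ ψ) ⇔ (∀ y → M._≤_ w x y → (w , y) ⊩' φ → (w , y) ⊩' ψ)
  ⊩'-⇒ φ ψ = mk⇔ (λ h y x≤y → h (_ , y) (inW x≤y))
                 (λ { h (_ , y) (inW x≤y) → h y x≤y })

  ⊩'-□ : ∀ {w x} φ → (w , x) ⊩' (□ φ) ⇔ (∀ v → R w v → (v , M.root v) ⊩' φ)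
  ⊩'-□ φ = mk⇔ (λ h v wRv → h _ (from R'-successors (v , wRv , refl)))
               (λ h z xR'z → ⊩'-root {φ = φ} h (to R'-successors xR'z))
    where
    ⊩'-root : ∀ {w φ z} → (∀ v → R w v → (v , M.root v) ⊩' φ) →
              Σ[ v ∈ W ] R w v × z ≡ (v , M.root v) → z ⊩' φ
    ⊩'-root h (v , wRv , refl) = h v wRv

  ⊩⇔⊩' : ∀ x φ → x ⊩ φ ⇔ x ⊩' φ
  ⊩⇔⊩' x `⊤ = ⇔-id _
  ⊩⇔⊩' x `⊥ = ⇔-id _
  ⊩⇔⊩' (w , x) (var p) = ⇔-id _
  ⊩⇔⊩' x (φ ∧ ψ) = ⊩⇔⊩' x φ ×-⇔ ⊩⇔⊩' x ψ
  ⊩⇔⊩' x (φ ∨ ψ) = ⊩⇔⊩' x φ ⊎-⇔ ⊩⇔⊩' x ψ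
  ⊩⇔⊩' (w , x) (φ ⇒ ψ) = ⇔-sym (⊩'-⇒ φ ψ) ⇔-∘ Π-cong-⇔ λ y → Π-cong-⇔ λ _ →
    →-cong-⇔ (⊩⇔⊩' (w , y) φ) (⊩⇔⊩' (w , y) ψ)
  ⊩⇔⊩' (w , x) (□ φ) = ⇔-sym (⊩'-□ φ) ⇔-∘ Π-cong-⇔ λ v → Π-cong-⇔ λ _ →
    ⊩⇔⊩' (v , M.root v) φ

theorem3p3p1 : {Prop : Set} (𝓜 : MixedModel Prop)
    → IsBirelational (Construction._≤'_ 𝓜) (Construction._R'_ 𝓜) (Construction.V' 𝓜)
      × BEM (Construction._≤'_ 𝓜) (Construction._R'_ 𝓜)
      × (∀ (x : Construction.W' 𝓜) (φ : Form Prop)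
           → MixedModel._⊩_ 𝓜 x φ ⇔ Construction._⊩'_ 𝓜 x φ)
theorem3p3p1 𝓜 = ≤'-R'-isBirelational 𝓜 , ≤'-R'-BEM 𝓜 , ⊩⇔⊩' 𝓜
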